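{- Let $\lambda$ be a partition with $r$ parts, $\rho=(r-1,\dots,0)$ and $\Theta'\in\{\Gamma,\Delta\}^{r-1}$. The map $\mathrm{sh}_{\Theta'}:\mathrm{GTP}_\lambda\to\mathrm{GTP}^{\Theta'}_{\lambda+\rho}$, $\mathfrak T\mapsto\mathfrak T+\rho^{\Theta'}$ (entrywise sum), is a bijection.
   Context: Gelfand–Tsetlin patterns with $r$ rows: arrays $(a_{i,j})_{0\le i\le j\le r-1}$ of nonnegative integers (row $i$ being $a_{i,i},\dots,a_{i,r-1}$) with $a_{i-1,j-1}\ge a_{i,j}\ge a_{i-1,j}$ for all $1\le i\le j\le r-1$. $\mathrm{GTP}_\nu$: patterns with $a_{0,j}=\nu_{j+1}$. The row pair $(i-1,i)$ is of type $\Gamma$ if $a_{i-1,j-1}>a_{i,j}\ge a_{i-1,j}$ for all $j$, of type $\Delta$ if $a_{i-1,j-1}\ge a_{i,j}>a_{i-1,j}$ for all $j$; $\mathrm{GTP}^{\Theta'}_\nu$ consists of the patterns in $\mathrm{GTP}_\nu$ whose row pair $(i-1,i)$ has type $\Theta'_i$ for $i=1,\dots,r-1$. The array $\rho^{\Theta'}$ is defined by: row $0$ is $(r-1,r-2,\dots,0)$, and for $i\ge1$ row $i$ is obtained from row $i-1$ by deleting its leftmost entry if $\Theta'_i=\Gamma$ and its rightmost entry if $\Theta'_i=\Delta$. -}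

module Defs where

open import Data.Nat using (ℕ; zero; suc; _+_; _∸_; _≤_; _<_; _≥_; _>_)
open import Data.Product using (_×_; Σ)
open import Relation.Binary.PropositionalEquality using (_≡_)

-- A (triangular) array: entry a i j is a_{i,j}; only the entries with
-- 0 ≤ i ≤ j ≤ r-1 are meaningful, the others are ignored everywhere.
Array : Set
Array = ℕ → ℕ → ℕ

_≈[_]_ : Array → ℕ → Array → Set
a ≈[ r ] b = ∀ i j → i ≤ j → j < r → a i j ≡ b i j

-- A sequence ν = (ν_1,…,ν_r) is stored 0-indexed: ν j = ν_{j+1}, j < r.
-- Partition with r parts: weakly decreasing sequence of r naturals.
IsPartition : ℕ → (ℕ → ℕ) → Set
IsPartition r ν = ∀ j → suc j < r → ν j ≥ ν (suc j)

GTP : ℕ → (ℕ → ℕ) → Array → Set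
GTP r ν a =
  (∀ j → j < r → a 0 j ≡ ν j) ×
  (∀ i k → i ≤ k → suc k < r → (a i k ≥ a (suc i) (suc k)) × (a (suc i) (suc k) ≥ a i (suc k)))

data GD : Set where
  Γ Δ : GD

PairType : ℕ → GD → Array → ℕ → Set
PairType r Γ a i = ∀ k → i ≤ k → suc k < r → (a i k > a (suc i) (suc k)) × (a (suc i) (suc k) ≥ a i (suc k))
PairType r Δ a i = ∀ k → i ≤ k → suc k < r → (a i k ≥ a (suc i) (suc k)) × (a (suc i) (suc k) > a i (suc k))

-- Θ' = (Θ'_1,…,Θ'_{r-1}) is given as a function ℕ → GD, with Θ' i = Θ'_i;
-- only the values at 1 ≤ i ≤ r-1 are used.
GTPΘ : ℕ → (ℕ → GD) → (ℕ → ℕ) → Array → Set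
GTPΘ r Θ ν a = GTP r ν a × (∀ i → suc i < r → PairType r (Θ (suc i)) a i)

ρ : ℕ → ℕ → ℕ
ρ r j = r ∸ 1 ∸ j

-- ρ^{Θ'}: row 0 is ρ (entries at columns 0..r-1); row i+1 (columns i+1..r-1)
-- is row i (columns i..r-1) with its leftmost entry deleted (Γ: column j of the
-- new row carries column j of the old row) or its rightmost entry deleted
-- (Δ: column j of the new row carries column j-1 of the old row).
ρΘ : ℕ → (ℕ → GD) → Array
ρΘ r Θ zero j = ρ r j
ρΘ r Θ (suc i) j with Θ (suc i)
... | Γ = ρΘ r Θ i j
... | Δ = ρΘ r Θ i (j ∸ 1)

_+ₛ_ : (ℕ → ℕ) → (ℕ → ℕ) → (ℕ → ℕ)
(f +ₛ g) j = f j + g j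

_+ₐ_ : Array → Array → Array
(a +ₐ b) i j = a i j + b i j

sh : ℕ → (ℕ → GD) → Array → Array
sh r Θ T = T +ₐ ρΘ r Θ

IsBijectionGT : ℕ → (ℕ → GD) → (ℕ → ℕ) → Set
IsBijectionGT r Θ lam =
  (∀ T → GTP r lam T → GTPΘ r Θ (lam +ₛ ρ r) (sh r Θ T)) ×
  (∀ T T′ → GTP r lam T → GTP r lam T′ → sh r Θ T ≈[ r ] sh r Θ T′ → T ≈[ r ] T′) ×
  (∀ S → GTPΘ r Θ (lam +ₛ ρ r) S → Σ Array (λ T → GTP r lam T × (sh r Θ T ≈[ r ] S)))

-- Along each row of ρ^{Θ'} consecutive entries differ by exactly 1, and an entry of row i+1
-- equals the entry of row i in the same column (Γ) or is one more (Δ).  So adding ρ^{Θ'} to a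
-- pattern turns the weak interlacing inequality on the Θ'_{i+1}-side into a strict one and leaves
-- the other weak; conversely a pattern of GTP^{Θ'}_{λ+ρ} dominates ρ^{Θ'} entrywise, and
-- subtracting ρ^{Θ'} from it gives back a pattern of GTP_λ.
module Submission where

open import Defs
open import Data.Nat using (ℕ; zero; suc; _+_; _∸_; _≤_; _<_; _≥_; _>_; s≤s)
open import Data.Nat.Properties
open import Data.Product using (_×_; Σ; _,_)
open import Relation.Binary.PropositionalEquality

m∸n≡1+m∸[1+n] : ∀ m n → suc n ≤ m → m ∸ n ≡ suc (m ∸ suc n)
m∸n≡1+m∸[1+n] (suc m) zero    _         = refl
m∸n≡1+m∸[1+n] (suc m) (suc n) (s≤s n<m) = m∸n≡1+m∸[1+n] m n n<m

offset : GD → ℕ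
offset Γ = 0
offset Δ = 1

StrictlyInterlaces : GD → ℕ → ℕ → ℕ → Set
StrictlyInterlaces Γ a b c = a > b × b ≥ c
StrictlyInterlaces Δ a b c = a ≥ b × b > c

strictlyInterlaces⇒interlaces : ∀ g {a b c} → StrictlyInterlaces g a b c → a ≥ b × b ≥ c
strictlyInterlaces⇒interlaces Γ (b<a , c≤b) = <⇒≤ b<a , c≤b
strictlyInterlaces⇒interlaces Δ (b≤a , c<b) = b≤a , <⇒≤ c<b

strictlyInterlaces⇒offset+≤ : ∀ g {a b c} → StrictlyInterlaces g a b c → offset g + c ≤ b
strictlyInterlaces⇒offset+≤ Γ (_ , c≤b) = c≤b
strictlyInterlaces⇒offset+≤ Δ (_ , c<b) = c<b

strictlyInterlaces-+ : ∀ g {a b c} p → a ≥ b → b ≥ c →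
                       StrictlyInterlaces g (a + suc p) (b + (offset g + p)) (c + p)
strictlyInterlaces-+ Γ p b≤a c≤b = +-mono-≤-< b≤a (n<1+n p) , +-monoˡ-≤ p c≤b
strictlyInterlaces-+ Δ p b≤a c≤b = +-monoˡ-≤ (suc p) b≤a , +-mono-≤-< c≤b (n<1+n p)

strictlyInterlaces-∸ : ∀ g {a b c} p → StrictlyInterlaces g a b c →
                       a ∸ suc p ≥ b ∸ (offset g + p) × b ∸ (offset g + p) ≥ c ∸ p
strictlyInterlaces-∸ Γ p (b<a , c≤b) = ∸-monoˡ-≤ (suc p) b<a , ∸-monoˡ-≤ p c≤b
strictlyInterlaces-∸ Δ p (b≤a , c<b) = ∸-monoˡ-≤ (suc p) b≤a , ∸-monoˡ-≤ (suc p) c<b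

Interlaced : ℕ → Array → ℕ → Set
Interlaced r a i = ∀ k → i ≤ k → suc k < r →
                   (a i k ≥ a (suc i) (suc k)) × (a (suc i) (suc k) ≥ a i (suc k))

-- PairType with the case split on the type moved inside, so that it unfolds for an unknown g.
StrictlyInterlaced : ℕ → GD → Array → ℕ → Set
StrictlyInterlaced r g a i = ∀ k → i ≤ k → suc k < r →
                             StrictlyInterlaces g (a i k) (a (suc i) (suc k)) (a i (suc k))

module _ {r : ℕ} {a : Array} {i : ℕ} where

  strictlyInterlaced⇒pairType : ∀ g → StrictlyInterlaced r g a i → PairType r g a i
  strictlyInterlaced⇒pairType Γ strict = strict
  strictlyInterlaced⇒pairType Δ strict = strict

  pairType⇒strictlyInterlaced : ∀ g → PairType r g a i → StrictlyInterlaced r g a i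
  pairType⇒strictlyInterlaced Γ pair = pair
  pairType⇒strictlyInterlaced Δ pair = pair

  pairType⇒interlaced : ∀ g → PairType r g a i → Interlaced r a i
  pairType⇒interlaced g pair k i≤k k<r =
    strictlyInterlaces⇒interlaces g (pairType⇒strictlyInterlaced g pair k i≤k k<r)

ρΘ-row-step : ∀ r Θ i k → i ≤ k → suc k < r → ρΘ r Θ i k ≡ suc (ρΘ r Θ i (suc k))
ρΘ-row-step (suc r) Θ zero    k       _         (s≤s k<r) = m∸n≡1+m∸[1+n] r k k<r
ρΘ-row-step r       Θ (suc i) (suc k) (s≤s i≤k) k<r with Θ (suc i)
... | Γ = ρΘ-row-step r Θ i (suc k) (m≤n⇒m≤1+n i≤k) k<r
... | Δ = ρΘ-row-step r Θ i k i≤k (<-trans (n<1+n (suc k)) k<r)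

ρΘ-column-step : ∀ r Θ i k → i ≤ k → suc k < r →
                 ρΘ r Θ (suc i) (suc k) ≡ offset (Θ (suc i)) + ρΘ r Θ i (suc k)
ρΘ-column-step r Θ i k i≤k k<r with Θ (suc i)
... | Γ = refl
... | Δ = ρΘ-row-step r Θ i k i≤k k<r

module _ (r : ℕ) (Θ : ℕ → GD) where

  private
    R : Array
    R = ρΘ r Θ

  sh-pairType : ∀ T i → Interlaced r T i → PairType r (Θ (suc i)) (sh r Θ T) i
  sh-pairType T i T-il = strictlyInterlaced⇒pairType (Θ (suc i)) λ k i≤k k<r →
    let (T≥ , ≥T) = T-il k i≤k k<r in
    subst₂ (λ x y → StrictlyInterlaces (Θ (suc i)) (T i k + x) (T (suc i) (suc k) + y)
                                        (T i (suc k) + R i (suc k)))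
           (sym (ρΘ-row-step r Θ i k i≤k k<r)) (sym (ρΘ-column-step r Θ i k i≤k k<r))
           (strictlyInterlaces-+ (Θ (suc i)) (R i (suc k)) T≥ ≥T)

  sh-GTP : ∀ lam T → GTP r lam T → GTPΘ r Θ (lam +ₛ ρ r) (sh r Θ T)
  sh-GTP lam T (top , T-il) =
    ((λ j j<r → cong (_+ ρ r j) (top j j<r)) ,
     (λ i → pairType⇒interlaced (Θ (suc i)) (sh-T-types i))) ,
    (λ i _ → sh-T-types i)
    where
    sh-T-types : ∀ i → PairType r (Θ (suc i)) (sh r Θ T) i
    sh-T-types i = sh-pairType T i (T-il i)

  ρΘ≤ : ∀ lam S → GTPΘ r Θ (lam +ₛ ρ r) S → ∀ i j → i ≤ j → j < r → R i j ≤ S i j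
  ρΘ≤ lam S ((top , _) , _) zero j _ j<r = subst (ρ r j ≤_) (sym (top j j<r)) (m≤n+m _ _)
  ρΘ≤ lam S G@(_ , types) (suc i) (suc k) (s≤s i≤k) k<r = begin
    R (suc i) (suc k)                   ≡⟨ ρΘ-column-step r Θ i k i≤k k<r ⟩
    offset (Θ (suc i)) + R i (suc k)    ≤⟨ +-monoʳ-≤ _ (ρΘ≤ lam S G i (suc k) (m≤n⇒m≤1+n i≤k) k<r) ⟩
    offset (Θ (suc i)) + S i (suc k)    ≤⟨ strictlyInterlaces⇒offset+≤ (Θ (suc i)) (S-strict k i≤k k<r) ⟩
    S (suc i) (suc k)                   ∎
    where
    open ≤-Reasoning
    S-strict : StrictlyInterlaced r (Θ (suc i)) S i
    S-strict = pairType⇒strictlyInterlaced (Θ (suc i)) (types i (≤-<-trans (s≤s i≤k) k<r))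

  unshift-GTP : ∀ lam S → GTPΘ r Θ (lam +ₛ ρ r) S → GTP r lam (λ i j → S i j ∸ R i j)
  unshift-GTP lam S ((top , _) , types) = top′ , S-il
    where
    top′ : ∀ j → j < r → S 0 j ∸ ρ r j ≡ lam j
    top′ j j<r = trans (cong (_∸ ρ r j) (top j j<r)) (m+n∸n≡m (lam j) (ρ r j))
    S-il : ∀ i → Interlaced r (λ i j → S i j ∸ R i j) i
    S-il i k i≤k k<r =
      subst₂ (λ x y → (S i k ∸ x ≥ S (suc i) (suc k) ∸ y) × (S (suc i) (suc k) ∸ y ≥ S i (suc k) ∸ R i (suc k)))
             (sym (ρΘ-row-step r Θ i k i≤k k<r)) (sym (ρΘ-column-step r Θ i k i≤k k<r))
             (strictlyInterlaces-∸ (Θ (suc i)) (R i (suc k))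
               (pairType⇒strictlyInterlaced (Θ (suc i)) (types i (≤-<-trans (s≤s i≤k) k<r)) k i≤k k<r))

lemma4p5 : (r : ℕ) (lam : ℕ → ℕ) (Θ : ℕ → GD) → IsPartition r lam → IsBijectionGT r Θ lam
lemma4p5 r lam Θ _ = sh-GTP r Θ lam , sh-injective , sh-surjective
  where
  sh-injective : ∀ T T′ → GTP r lam T → GTP r lam T′ → sh r Θ T ≈[ r ] sh r Θ T′ → T ≈[ r ] T′
  sh-injective T T′ _ _ eq i j i≤j j<r = +-cancelʳ-≡ _ _ _ (eq i j i≤j j<r)
  sh-surjective : ∀ S → GTPΘ r Θ (lam +ₛ ρ r) S → Σ Array (λ T → GTP r lam T × (sh r Θ T ≈[ r ] S))
  sh-surjective S G = (λ i j → S i j ∸ ρΘ r Θ i j) , unshift-GTP r Θ lam S G ,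
    λ i j i≤j j<r → m∸n+n≡m (ρΘ≤ r Θ lam S G i j i≤j j<r)
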